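{- For every simplicial model $\mathcal C$, $\mathcal C$ is isomorphic to $\mathtt{SC}(\mathtt{LEM}(\mathcal C))$; and for every local epistemic model $\mathcal M$, $\mathcal M^{pr}$ is isomorphic to $\mathtt{LEM}(\mathtt{SC}(\mathcal M))$. Consequently, for every proper local epistemic model $\mathcal M$, $\mathcal M$ is isomorphic to $\mathtt{LEM}(\mathtt{SC}(\mathcal M))$.
   Context: Fix a nonempty finite set $\mathbf{A}$ of agents and a countable set $\mathbf{P}$ of predicate letters. Simplicial model: $\mathcal{C}=(\mathcal{V},C,\chi,\ell)$ with $\mathcal{V}\neq\emptyset$, $C\subseteq\wp(\mathcal V)$, $\emptyset\notin C$, $C$ closed under nonempty subsets, all singletons in $C$, $\chi:\mathcal V\to\mathbf A$ injective on each face, $\ell:\mathbf P\to\wp(\mathcal V)$; facets $\mathcal F(C)$ are maximal faces. First-order Kripke model: $\mathcal{M}=(W,\delta,\{R_a\}_{a\in\mathbf A},\rho)$ with $W\neq\emptyset$, $\delta:W\to\wp(\mathbf A)\setminus\{\emptyset\}$, $R_a\subseteq W\times W$ with $R_a(w)=\emptyset$ if $a\notin\delta(w)$, $\rho:\mathbf P\times W\to\wp(\mathbf A)$ with $\rho(p,w)\subseteq\delta(w)$. Local epistemic model: a first-order Kripke model with (Local S5) each $R_a$ restricted to $\{w\mid a\in\delta(w)\}$ is an equivalence relation; (Individually Increasing Domain) $a\in\delta(w)$, $wR_av$ imply $a\in\delta(v)$; (Local Predicates) $a\in\rho(p,w)$, $wR_av$ imply $a\in\rho(p,v)$; (Collectively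 Decreasing Domain) $v\in\bigcap_{a\in\delta(w)}R_a(w)$ implies $\delta(v)\subseteq\delta(w)$. Proper: additionally $\bigcap_{a\in\delta(w)}R_a(w)=\{w\}$ for all $w$. Properization: with $[w]_\delta=\bigcap_{a\in\delta(w)}R_a(w)$, $\mathcal M^{pr}$ has worlds $\{[w]_\delta\mid w\in W\}$, $\delta^{pr}([w]_\delta)=\delta(w)$, $R^{pr}_a=\{([w]_\delta,[v]_\delta)\mid wR_av\}$, $\rho^{pr}(p,[w]_\delta)=\rho(p,w)$. $\mathtt{LEM}(\mathcal C)$: worlds $\mathcal F(C)$, $\delta(F)=\chi[F]$, $R_a=\{(F,G)\mid a\in\chi[F\cap G]\}$, $\rho(p,F)=\chi[F\cap\ell(p)]$. $\mathtt{SC}(\mathcal M)$: with $[w]_a=R_a(w)$ and $F^{\mathcal M}_w=\{(a,[w]_a)\mid a\in\delta(w)\}$, vertices $\{(a,[w]_a)\mid w\in W,a\in\delta(w)\}$, faces the nonempty subsets of some $F^{\mathcal M}_w$, coloring $(a,[w]_a)\mapsto a$, $\ell(p)=\{(a,[w]_a)\mid a\in\rho(p,w)\}$. Isomorphism of simplicial models: a bijection of vertices mapping faces exactly onto faces and preserving colors and labels. Isomorphism of first-order Kripke models: a bijection of worlds preserving $\delta$, each $R_a$ and $\rho$. -}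

module Defs where

open import Level using (Level; _⊔_; 0ℓ; Lift; lift) renaming (suc to lsuc)
open import Data.Nat using (ℕ) renaming (suc to nsuc)
open import Data.Fin using (Fin)
open import Data.Fin.Subset using (Subset; Nonempty; ⁅_⁆; _∪_) renaming (_∈_ to _∈ₐ_; ⊥ to ∅ₐ)
open import Data.List using (List; []; _∷_; map)
open import Data.List.Relation.Unary.All using (All)
open import Data.Product using (Σ; ∃; _×_; _,_; proj₁; proj₂)
open import Relation.Binary.Bundles using (Setoid)
open import Relation.Binary.PropositionalEquality using (_≡_; _≢_)
import Relation.Binary.PropositionalEquality as ≡
open import Relation.Nullary using (¬_)
open import Function.Bundles using (_⇔_)
import Function.Properties.Equivalence as ⇔
import Data.List.Membership.Setoid as SetoidMembership
import Data.List.Relation.Binary.Subset.Setoid as SetoidSubset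

module Models (n : ℕ) (P : Set) where

  Agent : Set
  Agent = Fin (nsuc n)

  AgentSet : Set
  AgentSet = Subset (nsuc n)

  -- Vertices form a setoid; since χ is
  -- injective on faces and 𝐀 is finite, every face is finite, so faces are
  -- represented by (nonempty) lists of vertices, read as finite sets
  -- (membership / inclusion up to the vertex equality).

  record SimplicialModel (c e ℓ : Level) : Set (lsuc (c ⊔ e ⊔ ℓ)) where
    field
      V   : Setoid c e
      C   : List (Setoid.Carrier V) → Set ℓ
      χ   : Setoid.Carrier V → Agent
      lab : P → Setoid.Carrier V → Set ℓ

  module _ {c e ℓ} (𝒞 : SimplicialModel c e ℓ) where
    open SimplicialModel 𝒞
    open Setoid V renaming (Carrier to Vtx)
    open SetoidMembership V using (_∈_)
    open SetoidSubset V using (_⊆_)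

    record IsSimplicialModel : Set (c ⊔ e ⊔ ℓ) where
      field
        vertices-nonempty : Vtx
        C-resp      : ∀ {X Y} → X ⊆ Y → Y ⊆ X → C X → C Y
        C-no-empty  : ¬ C []
        C-down      : ∀ {X Y} → C X → Y ⊆ X → Y ≢ [] → C Y
        C-singleton : ∀ v → C (v ∷ [])
        χ-resp      : ∀ {x y} → x ≈ y → χ x ≡ χ y
        χ-inj       : ∀ {X x y} → C X → x ∈ X → y ∈ X → χ x ≡ χ y → x ≈ y
        lab-resp    : ∀ p {x y} → x ≈ y → lab p x → lab p y

    IsFacet : List Vtx → Set (c ⊔ e ⊔ ℓ)
    IsFacet F = C F × (∀ G → C G → F ⊆ G → G ⊆ F)

    colors : List Vtx → AgentSet
    colors []       = ∅ₐ
    colors (v ∷ vs) = ⁅ χ v ⁆ ∪ colors vs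

  record KripkeModel (c e r : Level) : Set (lsuc (c ⊔ e ⊔ r)) where
    field
      W : Setoid c e
      δ : Setoid.Carrier W → AgentSet
      R : Agent → Setoid.Carrier W → Setoid.Carrier W → Set r
      ρ : P → Setoid.Carrier W → Agent → Set r

  module _ {c e r} (ℳ : KripkeModel c e r) where
    open KripkeModel ℳ
    open Setoid W renaming (Carrier to World)

    record IsKripkeModel : Set (c ⊔ e ⊔ r) where
      field
        worlds-nonempty : World
        δ-resp     : ∀ {x y} → x ≈ y → δ x ≡ δ y
        δ-nonempty : ∀ w → Nonempty (δ w)
        R-resp     : ∀ {a x x' y y'} → x ≈ x' → y ≈ y' → R a x y → R a x' y'
        R-dom      : ∀ {a w v} → R a w v → a ∈ₐ δ w
        ρ-resp     : ∀ {p a x y} → x ≈ y → ρ p x a → ρ p y a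
        ρ⊆δ        : ∀ {p a w} → ρ p w a → a ∈ₐ δ w

    Cls : World → World → Set r
    Cls w u = ∀ a → a ∈ₐ δ w → R a w u

    record IsLocalEpistemicModel : Set (c ⊔ e ⊔ r) where
      field
        isKripke : IsKripkeModel
        S5-refl  : ∀ {a w} → a ∈ₐ δ w → R a w w
        S5-sym   : ∀ {a w v} → a ∈ₐ δ w → a ∈ₐ δ v → R a w v → R a v w
        S5-trans : ∀ {a w v u} → a ∈ₐ δ w → a ∈ₐ δ v → a ∈ₐ δ u →
                   R a w v → R a v u → R a w u
        individually-increasing : ∀ {a w v} → a ∈ₐ δ w → R a w v → a ∈ₐ δ v
        local-predicates : ∀ {p a w v} → ρ p w a → R a w v → ρ p v a
        collectively-decreasing : ∀ {w v} → Cls w v → ∀ {a} → a ∈ₐ δ v → a ∈ₐ δ w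

    record IsProperLocalEpistemicModel : Set (c ⊔ e ⊔ r) where
      field
        isLocalEpistemic : IsLocalEpistemicModel
        proper : ∀ w v → Cls w v ⇔ (v ≈ w)

    -- Properization ℳ^pr: worlds are the sets [w]_δ, i.e. representatives w
    -- identified when [w]_δ = [v]_δ as sets of worlds.
    properization : KripkeModel c (c ⊔ r) (c ⊔ r)
    properization = record
      { W = record
          { Carrier = World
          ; _≈_ = λ x y → ∀ u → Cls x u ⇔ Cls y u
          ; isEquivalence = record
              { refl  = λ u → ⇔.refl
              ; sym   = λ p u → ⇔.sym (p u)
              ; trans = λ p q u → ⇔.trans (p u) (q u) } }
      ; δ = δ
      ; R = λ a x y → ∃ λ w → ∃ λ v →
              (∀ u → Cls w u ⇔ Cls x u) × (∀ u → Cls v u ⇔ Cls y u) × R a w v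
      ; ρ = λ p x a → Lift c (ρ p x a) }

  LEM : ∀ {c e ℓ} → SimplicialModel c e ℓ → KripkeModel (c ⊔ e ⊔ ℓ) (c ⊔ e) (c ⊔ e ⊔ ℓ)
  LEM {c} {e} {ℓ} 𝒞 = record
    { W = record
        { Carrier = Σ (List Vtx) (IsFacet 𝒞)
        ; _≈_ = λ F G → proj₁ F ⊆ proj₁ G × proj₁ G ⊆ proj₁ F
        ; isEquivalence = record
            { refl  = (λ x → x) , (λ x → x)
            ; sym   = λ { (p , q) → q , p }
            ; trans = λ { (p , q) (p' , q') → (λ x → p' (p x)) , (λ x → q (q' x)) } } }
    ; δ = λ F → colors 𝒞 (proj₁ F)
    ; R = λ a F G → Lift ℓ (∃ λ v → v ∈ proj₁ F × v ∈ proj₁ G × χ v ≡ a)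
    ; ρ = λ p F a → ∃ λ v → v ∈ proj₁ F × lab p v × χ v ≡ a }
    where
      open SimplicialModel 𝒞
      open Setoid V renaming (Carrier to Vtx)
      open SetoidMembership V using (_∈_)
      open SetoidSubset V using (_⊆_)

  -- SC(ℳ): vertices (a,[w]_a) with a ∈ δ(w), represented by (a,w) and
  -- identified when the agents agree and [w]_a = R_a(w) agree as sets;
  -- faces are the nonempty subsets of some F_w = {(a,[w]_a) | a ∈ δ(w)}.

  SC : ∀ {c e r} → KripkeModel c e r → SimplicialModel c (c ⊔ r) (c ⊔ r)
  SC {c} {e} {r} ℳ = record
    { V = Vset
    ; C = λ X → X ≢ [] × ∃ λ w → All (InF w) X
    ; χ = proj₁
    ; lab = λ p x → Lift c (ρ p (proj₁ (proj₂ x)) (proj₁ x)) }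
    where
      open KripkeModel ℳ
      open Setoid W renaming (Carrier to World)
      Vtx : Set c
      Vtx = Σ Agent λ a → Σ World λ w → a ∈ₐ δ w
      Vset : Setoid c (c ⊔ r)
      Vset = record
        { Carrier = Vtx
        ; _≈_ = λ x y → proj₁ x ≡ proj₁ y ×
                  (∀ t → R (proj₁ x) (proj₁ (proj₂ x)) t ⇔ R (proj₁ y) (proj₁ (proj₂ y)) t)
        ; isEquivalence = record
            { refl  = ≡.refl , (λ t → ⇔.refl)
            ; sym   = λ { (p , q) → ≡.sym p , (λ t → ⇔.sym (q t)) }
            ; trans = λ { (p , q) (p' , q') → ≡.trans p p' , (λ t → ⇔.trans (q t) (q' t)) } } }
      InF : World → Vtx → Set (c ⊔ r)
      InF w x = proj₁ x ∈ₐ δ w × (∀ t → R (proj₁ x) (proj₁ (proj₂ x)) t ⇔ R (proj₁ x) w t)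

  record _≅ˢ_ {c₁ e₁ ℓ₁ c₂ e₂ ℓ₂}
              (𝒞 : SimplicialModel c₁ e₁ ℓ₁) (𝒟 : SimplicialModel c₂ e₂ ℓ₂)
              : Set (c₁ ⊔ e₁ ⊔ ℓ₁ ⊔ c₂ ⊔ e₂ ⊔ ℓ₂) where
    private
      module 𝒞 = SimplicialModel 𝒞
      module 𝒟 = SimplicialModel 𝒟
      module V₁ = Setoid 𝒞.V
      module V₂ = Setoid 𝒟.V
    open SetoidSubset 𝒟.V using (_⊆_)
    field
      f        : V₁.Carrier → V₂.Carrier
      f-cong   : ∀ {x y} → x V₁.≈ y → f x V₂.≈ f y
      f-inj    : ∀ {x y} → f x V₂.≈ f y → x V₁.≈ y
      f-surj   : ∀ y → ∃ λ x → f x V₂.≈ y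
      f-color  : ∀ v → 𝒟.χ (f v) ≡ 𝒞.χ v
      f-label  : ∀ p v → 𝒞.lab p v ⇔ 𝒟.lab p (f v)
      f-faces  : ∀ X → 𝒞.C X → 𝒟.C (map f X)
      f-faces⁻ : ∀ Y → 𝒟.C Y → ∃ λ X → 𝒞.C X × map f X ⊆ Y × Y ⊆ map f X

  record _≅ᴷ_ {c₁ e₁ r₁ c₂ e₂ r₂}
              (ℳ : KripkeModel c₁ e₁ r₁) (𝒩 : KripkeModel c₂ e₂ r₂)
              : Set (c₁ ⊔ e₁ ⊔ r₁ ⊔ c₂ ⊔ e₂ ⊔ r₂) where
    private
      module ℳ = KripkeModel ℳ
      module 𝒩 = KripkeModel 𝒩
      module W₁ = Setoid ℳ.W
      module W₂ = Setoid 𝒩.W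
    field
      f       : W₁.Carrier → W₂.Carrier
      f-cong  : ∀ {x y} → x W₁.≈ y → f x W₂.≈ f y
      f-inj   : ∀ {x y} → f x W₂.≈ f y → x W₁.≈ y
      f-surj  : ∀ y → ∃ λ x → f x W₂.≈ y
      f-δ     : ∀ w → 𝒩.δ (f w) ≡ ℳ.δ w
      f-R     : ∀ a w v → ℳ.R a w v ⇔ 𝒩.R a (f w) (f v)
      f-ρ     : ∀ p w a → ℳ.ρ p w a ⇔ 𝒩.ρ p (f w) a

-- From a local epistemic model: the relation Cls w v (v ∈ [w]_δ) is an equivalence
-- relation, symmetric by Collectively Decreasing Domain and Local S5.  So two worlds are
-- identified in ℳ^pr exactly when they are Cls-related, which in turn holds exactly when
-- F_w ⊆ F_v.  Hence w ↦ F_w is injective on ℳ^pr, every facet of SC(ℳ) is some F_w,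
-- and R_a and ρ are recovered from shared and labelled vertices.  A proper model is
-- isomorphic to its own properization, which gives the last part.
--
-- From a simplicial model: every face extends to a facet, built agent by agent by
-- adding a vertex of that colour whenever some face allows it (decided by excluded
-- middle).  The map v ↦ (χ v, [F]_{χ v}) for any facet F ∋ v is then the isomorphism:
-- since χ is injective on faces, the R_{χ v}-class of F is exactly the set of facets
-- containing v.

module Submission where

open import Defs
open import Level using (_⊔_; 0ℓ; lift; lower)
open import Data.Nat using (ℕ) renaming (suc to nsuc)
open import Data.Product using (_×_; Σ; ∃; _,_; proj₁; proj₂)
open import Data.Sum using (_⊎_; inj₁; inj₂)
open import Data.Empty using (⊥-elim)
open import Function.Bundles using (_↣_; _⇔_; mk⇔; Equivalence)
import Function.Properties.Equivalence as ⇔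
open import Axiom.ExcludedMiddle using (ExcludedMiddle)
open import Data.Fin.Subset using (⁅_⁆) renaming (_∈_ to _∈ₐ_)
open import Data.Fin.Subset.Properties
  using (x∈⁅x⁆; x∈⁅y⁆⇒x≡y; x∈p∪q⁻; x∈p∪q⁺; ⊆-antisym; ∉⊥; _∈?_)
open import Data.List using (List; []; _∷_; map; allFin)
open import Data.List.Relation.Unary.Any using (Any; here; there)
import Data.List.Relation.Unary.Any as Any
open import Data.List.Relation.Unary.Any.Properties using (¬Any[])
open import Data.List.Relation.Unary.All using (All; []; _∷_; reduce)
import Data.List.Relation.Unary.All as All
import Data.List.Relation.Unary.All.Properties as Allₚ
open import Data.List.Membership.Propositional using () renaming (_∈_ to _∈ₚ_)
open import Data.List.Membership.Propositional.Properties using (∈-allFin)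
open import Relation.Binary.Bundles using (Setoid)
open import Relation.Binary.PropositionalEquality using (_≡_; _≢_; refl; sym; trans; subst)
open import Relation.Nullary using (yes; no)
import Data.List.Membership.Setoid as SetoidMembership
import Data.List.Relation.Binary.Subset.Setoid as SetoidSubset
import Data.List.Membership.Setoid.Properties as SetoidMembershipₚ

open Equivalence using (to; from)

Any⇒≢[] : ∀ {a p} {A : Set a} {Q : A → Set p} {xs : List A} → Any Q xs → xs ≢ []
Any⇒≢[] q refl = ¬Any[] q

module _ {s ℓ} (S : Setoid s ℓ) where
  open Setoid S using (Carrier; _≈_) renaming (sym to ≈-sym; trans to ≈-trans)
  open SetoidMembership S using (_∈_)
  open SetoidSubset S using (_⊆_)

  reduce-⊆ : ∀ {b q} {B : Set b} {Q : B → Set q} (g : ∀ {y} → Q y → Carrier) {xs} →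
             (∀ {y} (qy : Q y) → g qy ∈ xs) → ∀ {ys} (qs : All Q ys) → reduce g qs ⊆ xs
  reduce-⊆ g g∈ (qy ∷ qs) (here x≈) = SetoidMembershipₚ.∈-resp-≈ S (≈-sym x≈) (g∈ qy)
  reduce-⊆ g g∈ (qy ∷ qs) (there x∈) = reduce-⊆ g g∈ qs x∈

  module _ {a q} {A : Set a} {Q : Carrier → Set q} (f : A → Carrier) (g : ∀ {y} → Q y → A)
           (f∘g≈id : ∀ {y} (qy : Q y) → f (g qy) ≈ y) where

    map-reduce-⊆ : ∀ {ys} (qs : All Q ys) → map f (reduce g qs) ⊆ ys
    map-reduce-⊆ (qy ∷ qs) (here x≈)  = here (≈-trans x≈ (f∘g≈id qy))
    map-reduce-⊆ (qy ∷ qs) (there x∈) = there (map-reduce-⊆ qs x∈)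

    ⊆-map-reduce : ∀ {ys} (qs : All Q ys) → ys ⊆ map f (reduce g qs)
    ⊆-map-reduce (qy ∷ qs) (here x≈)  = here (≈-trans x≈ (≈-sym (f∘g≈id qy)))
    ⊆-map-reduce (qy ∷ qs) (there x∈) = there (⊆-map-reduce qs x∈)

module Duality (n : ℕ) (P : Set) where
  open Models n P

  module _ {c e ℓ} (𝒞 : SimplicialModel c e ℓ) where
    open SimplicialModel 𝒞

    ∈-colors⁻ : ∀ {a} X → a ∈ₐ colors 𝒞 X → Any (λ u → χ u ≡ a) X
    ∈-colors⁻ []      a∈ = ⊥-elim (∉⊥ a∈)
    ∈-colors⁻ (v ∷ X) a∈ with x∈p∪q⁻ ⁅ χ v ⁆ (colors 𝒞 X) a∈
    ... | inj₁ a∈χv = here (sym (x∈⁅y⁆⇒x≡y (χ v) a∈χv))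
    ... | inj₂ a∈X  = there (∈-colors⁻ X a∈X)

    ∈-colors⁺ : ∀ {a} X → Any (λ u → χ u ≡ a) X → a ∈ₐ colors 𝒞 X
    ∈-colors⁺ (v ∷ X) (here refl) = x∈p∪q⁺ (inj₁ (x∈⁅x⁆ (χ v)))
    ∈-colors⁺ (v ∷ X) (there a∈X) = x∈p∪q⁺ (inj₂ (∈-colors⁺ X a∈X))

  module Simplicial {c e ℓ} {𝒞 : SimplicialModel c e ℓ} (I : IsSimplicialModel 𝒞) where
    open SimplicialModel 𝒞
    open Setoid V using (_≈_) renaming (Carrier to Vtx; refl to ≈-refl; sym to ≈-sym)
    open SetoidMembership V using (_∈_; find)
    open SetoidSubset V using (_⊆_)
    open IsSimplicialModel I

    ∈-resp-≈ : ∀ {x y xs} → x ≈ y → x ∈ xs → y ∈ xs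
    ∈-resp-≈ = SetoidMembershipₚ.∈-resp-≈ V

    χ∈colors : ∀ {v X} → v ∈ X → χ v ∈ₐ colors 𝒞 X
    χ∈colors {X = X} v∈X = ∈-colors⁺ 𝒞 X (Any.map (λ v≈u → sym (χ-resp v≈u)) v∈X)

    ∈-colors⇒∃ : ∀ {a} X → a ∈ₐ colors 𝒞 X → ∃ λ u → u ∈ X × χ u ≡ a
    ∈-colors⇒∃ X a∈ = find (∈-colors⁻ 𝒞 X a∈)

    Facet : Set (c ⊔ e ⊔ ℓ)
    Facet = Σ (List Vtx) (IsFacet 𝒞)

    module LEM = KripkeModel (LEM 𝒞)

    R-LEM-χ⇔∈ : ∀ {v} (F H : Facet) → v ∈ proj₁ F → LEM.R (χ v) F H ⇔ v ∈ proj₁ H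
    R-LEM-χ⇔∈ {v} (F , isFace , _) H v∈F = mk⇔
      (λ { (lift (u , u∈F , u∈H , χu≡χv)) → ∈-resp-≈ (χ-inj isFace u∈F v∈F χu≡χv) u∈H })
      (λ v∈H → lift (v , v∈F , v∈H , refl))

    R-LEM-χ-class : ∀ {v} (F G : Facet) → v ∈ proj₁ F → v ∈ proj₁ G →
                    ∀ H → LEM.R (χ v) F H ⇔ LEM.R (χ v) G H
    R-LEM-χ-class F G v∈F v∈G H = ⇔.trans (R-LEM-χ⇔∈ F H v∈F) (⇔.sym (R-LEM-χ⇔∈ G H v∈G))

    SaturatedFor : List Agent → List Vtx → Set (c ⊔ e ⊔ ℓ)
    SaturatedFor as G = ∀ {a} → a ∈ₚ as →
      (∃ λ u → u ∈ G × χ u ≡ a) ⊎ (∀ G' → C G' → G ⊆ G' → ∀ {x} → x ∈ G' → χ x ≢ a)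

    SaturatedFor-mono : ∀ {as G G'} → G ⊆ G' → SaturatedFor as G → SaturatedFor as G'
    SaturatedFor-mono G⊆G' sat a∈as with sat a∈as
    ... | inj₁ (u , u∈G , χu≡a) = inj₁ (u , G⊆G' u∈G , χu≡a)
    ... | inj₂ absent          =
      inj₂ (λ G'' isFace G'⊆G'' → absent G'' isFace (λ x∈G → G'⊆G'' (G⊆G' x∈G)))

    saturated⇒isFacet : ∀ {G} → C G → SaturatedFor (allFin (nsuc n)) G → IsFacet 𝒞 G
    saturated⇒isFacet {G} isFace sat = isFace , maximal
      where
        maximal : ∀ G' → C G' → G ⊆ G' → G' ⊆ G
        maximal G' isFace' G⊆G' {x} x∈G' with sat (∈-allFin (χ x))
        ... | inj₁ (u , u∈G , χu≡χx) = ∈-resp-≈ (χ-inj isFace' (G⊆G' u∈G) x∈G' χu≡χx) u∈G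
        ... | inj₂ absent           = ⊥-elim (absent G' isFace' G⊆G' x∈G' refl)

    module _ (em : ExcludedMiddle (c ⊔ ℓ)) where

      saturate : ∀ {X} → C X → ∀ as → ∃ λ G → C G × X ⊆ G × SaturatedFor as G
      saturate {X} isFace [] = X , isFace , (λ x∈X → x∈X) , λ ()
      saturate isFace (b ∷ as) with saturate isFace as
      ... | G , isFaceG , X⊆G , sat with em {∃ λ x → C (x ∷ G) × χ x ≡ b}
      ...   | yes (x , isFace' , χx≡b) =
                x ∷ G , isFace' , (λ x∈X → there (X⊆G x∈X)) , saturated-with-x
        where
          saturated-with-x : SaturatedFor (b ∷ as) (x ∷ G)
          saturated-with-x (here refl)  = inj₁ (x , here ≈-refl , χx≡b)
          saturated-with-x (there a∈as) = SaturatedFor-mono there sat a∈as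
      ...   | no ∄x = G , isFaceG , X⊆G , saturated-without-b
        where
          saturated-without-b : SaturatedFor (b ∷ as) G
          saturated-without-b (here refl) = inj₂ λ G' isFace' G⊆G' {y} y∈G' χy≡b →
            ∄x (y , C-down isFace' (λ { (here z≈y)  → ∈-resp-≈ (≈-sym z≈y) y∈G'
                                      ; (there z∈G) → G⊆G' z∈G })
                              (λ ()) , χy≡b)
          saturated-without-b (there a∈as) = sat a∈as

      facetContaining : ∀ {X} → C X → Σ Facet λ F → X ⊆ proj₁ F
      facetContaining isFace with saturate isFace (allFin (nsuc n))
      ... | G , isFaceG , X⊆G , sat = (G , saturated⇒isFacet isFaceG sat) , X⊆G

      facetAt : Vtx → Facet
      facetAt v = proj₁ (facetContaining (C-singleton v))

      ∈-facetAt : ∀ v → v ∈ proj₁ (facetAt v)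
      ∈-facetAt v = proj₂ (facetContaining (C-singleton v)) (here ≈-refl)

      private
        module T = SimplicialModel (SC (LEM 𝒞))
        module Tᵥ = Setoid T.V
      open SetoidSubset T.V using () renaming (_⊆_ to _⊆ₜ_)

      InFacet : Facet → Tᵥ.Carrier → Set (c ⊔ e ⊔ ℓ)
      InFacet F y = proj₁ y ∈ₐ colors 𝒞 (proj₁ F) ×
                    (∀ H → LEM.R (proj₁ y) (proj₁ (proj₂ y)) H ⇔ LEM.R (proj₁ y) F H)

      toSC : Vtx → Tᵥ.Carrier
      toSC v = χ v , facetAt v , χ∈colors (∈-facetAt v)

      toSC-cong : ∀ {x y} → x ≈ y → toSC x Tᵥ.≈ toSC y
      toSC-cong {x} {y} x≈y = χ-resp x≈y , λ H →
        ⇔.trans (R-LEM-χ⇔∈ (facetAt x) H (∈-facetAt x))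
          (⇔.trans (mk⇔ (∈-resp-≈ x≈y) (∈-resp-≈ (≈-sym x≈y)))
                   (⇔.sym (R-LEM-χ⇔∈ (facetAt y) H (∈-facetAt y))))

      toSC-inj : ∀ {x y} → toSC x Tᵥ.≈ toSC y → x ≈ y
      toSC-inj {x} {y} (χx≡χy , sameClass) =
        χ-inj (proj₁ (proj₂ (facetAt x))) (∈-facetAt x) y∈Fx χx≡χy
        where
          y∈Fx : y ∈ proj₁ (facetAt x)
          y∈Fx = to (R-LEM-χ⇔∈ (facetAt y) (facetAt x) (∈-facetAt y))
                   (to (sameClass (facetAt x))
                       (from (R-LEM-χ⇔∈ (facetAt x) (facetAt x) (∈-facetAt x)) (∈-facetAt x)))

      toSC≈ : ∀ {F u y} → InFacet F y → u ∈ proj₁ F → χ u ≡ proj₁ y → toSC u Tᵥ.≈ y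
      toSC≈ {F} {u} (_ , sameClass) u∈F refl =
        refl , λ H → ⇔.trans (R-LEM-χ-class (facetAt u) F (∈-facetAt u) u∈F H) (⇔.sym (sameClass H))

      toSC-surj : ∀ y → ∃ λ x → toSC x Tᵥ.≈ y
      toSC-surj (a , F , a∈F) =
        let u , u∈F , χu≡a = ∈-colors⇒∃ (proj₁ F) a∈F
        in  u , toSC≈ {F} {y = a , F , a∈F} (a∈F , λ H → ⇔.refl) u∈F χu≡a

      toSC-label : ∀ p v → lab p v ⇔ T.lab p (toSC v)
      toSC-label p v = mk⇔
        (λ pv → lift (v , ∈-facetAt v , pv , refl))
        (λ { (lift (u , u∈F , pu , χu≡χv)) →
               lab-resp p (χ-inj (proj₁ (proj₂ (facetAt v))) u∈F (∈-facetAt v) χu≡χv) pu })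

      toSC-faces : ∀ X → C X → T.C (map toSC X)
      toSC-faces []      isFace = ⊥-elim (C-no-empty isFace)
      toSC-faces (x ∷ X) isFace =
        (λ ()) , F , Allₚ.map⁺ (All.tabulateₛ V (λ v∈ → inF (X⊆F v∈)))
        where
          F : Facet
          F = proj₁ (facetContaining isFace)
          X⊆F : x ∷ X ⊆ proj₁ F
          X⊆F = proj₂ (facetContaining isFace)
          inF : ∀ {v} → v ∈ proj₁ F → InFacet F (toSC v)
          inF {v} v∈F = χ∈colors v∈F , R-LEM-χ-class (facetAt v) F (∈-facetAt v) v∈F

      toSC-faces⁻ : ∀ Y → T.C Y → ∃ λ X → C X × map toSC X ⊆ₜ Y × Y ⊆ₜ map toSC X
      toSC-faces⁻ [] (Y≢[] , _) = ⊥-elim (Y≢[] refl)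
      toSC-faces⁻ Y@(_ ∷ _) (_ , F , inY@(_ ∷ _)) =
        X , C-down (proj₁ (proj₂ F)) X⊆F (λ ()) , (λ {z} → image⊆Y {z}) , (λ {z} → Y⊆image {z})
        where
          witness : ∀ {y} → InFacet F y → ∃ λ u → u ∈ proj₁ F × χ u ≡ proj₁ y
          witness i = ∈-colors⇒∃ (proj₁ F) (proj₁ i)
          pick : ∀ {y} → InFacet F y → Vtx
          pick {y} i = proj₁ (witness {y} i)
          pick∈F : ∀ {y} (i : InFacet F y) → pick {y} i ∈ proj₁ F
          pick∈F {y} i = proj₁ (proj₂ (witness {y} i))
          toSC∘pick≈id : ∀ {y} (i : InFacet F y) → toSC (pick {y} i) Tᵥ.≈ y
          toSC∘pick≈id {y} i = toSC≈ {F} {y = y} i (pick∈F {y} i) (proj₂ (proj₂ (witness {y} i)))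
          X : List Vtx
          X = reduce (λ {y} → pick {y}) inY
          X⊆F : X ⊆ proj₁ F
          X⊆F = reduce-⊆ V {Q = InFacet F} (λ {y} → pick {y}) (λ {y} → pick∈F {y}) inY
          image⊆Y : map toSC X ⊆ₜ Y
          image⊆Y {z} = map-reduce-⊆ T.V {Q = InFacet F} toSC (λ {y} → pick {y})
                          (λ {y} → toSC∘pick≈id {y}) inY {z}
          Y⊆image : Y ⊆ₜ map toSC X
          Y⊆image {z} = ⊆-map-reduce T.V {Q = InFacet F} toSC (λ {y} → pick {y})
                          (λ {y} → toSC∘pick≈id {y}) inY {z}

      ≅SC-LEM : 𝒞 ≅ˢ SC (LEM 𝒞)
      ≅SC-LEM = record
        { f        = toSC
        ; f-cong   = toSC-cong
        ; f-inj    = toSC-inj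
        ; f-surj   = toSC-surj
        ; f-color  = λ v → refl
        ; f-label  = toSC-label
        ; f-faces  = toSC-faces
        ; f-faces⁻ = toSC-faces⁻
        }

  module LocalEpistemic {c e r} {ℳ : KripkeModel c e r} (L : IsLocalEpistemicModel ℳ) where
    open KripkeModel ℳ
    open Setoid W using () renaming (Carrier to World)
    open IsLocalEpistemicModel L
    open IsKripkeModel isKripke

    R-class : ∀ {a w v} → a ∈ₐ δ w → R a w v → ∀ t → R a w t ⇔ R a v t
    R-class a∈w wRv t = mk⇔
      (λ wRt → S5-trans a∈v a∈w (individually-increasing a∈w wRt) (S5-sym a∈w a∈v wRv) wRt)
      (λ vRt → S5-trans a∈w a∈v (individually-increasing a∈v vRt) wRv vRt)
      where a∈v = individually-increasing a∈w wRv

    Cls-δ : ∀ {w v} → Cls ℳ w v → ∀ {a} → a ∈ₐ δ w → a ∈ₐ δ v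
    Cls-δ w~v a∈w = individually-increasing a∈w (w~v _ a∈w)

    Cls-refl : ∀ w → Cls ℳ w w
    Cls-refl w a a∈w = S5-refl a∈w

    Cls-sym : ∀ {w v} → Cls ℳ w v → Cls ℳ v w
    Cls-sym w~v a a∈v = S5-sym a∈w a∈v (w~v a a∈w)
      where a∈w = collectively-decreasing w~v a∈v

    Cls-trans : ∀ {w v u} → Cls ℳ w v → Cls ℳ v u → Cls ℳ w u
    Cls-trans w~v v~u a a∈w =
      S5-trans a∈w a∈v (Cls-δ v~u a∈v) (w~v a a∈w) (v~u a a∈v)
      where a∈v = Cls-δ w~v a∈w

    ≈ᵖʳ⇔Cls : ∀ {w v} → (∀ u → Cls ℳ w u ⇔ Cls ℳ v u) ⇔ Cls ℳ w v
    ≈ᵖʳ⇔Cls {w} = mk⇔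
      (λ w≈v → Cls-sym (to (w≈v w) (Cls-refl w)))
      (λ w~v u → mk⇔ (Cls-trans (Cls-sym w~v)) (Cls-trans w~v))

    properization-R⇔R : ∀ {a x y} →
      (∃ λ w → ∃ λ v → (∀ u → Cls ℳ w u ⇔ Cls ℳ x u) × (∀ u → Cls ℳ v u ⇔ Cls ℳ y u) × R a w v)
      ⇔ R a x y
    properization-R⇔R {a} {x} {y} = mk⇔
      (λ { (w , v , w≈x , v≈y , wRv) → xRy (to ≈ᵖʳ⇔Cls w≈x) (to ≈ᵖʳ⇔Cls v≈y) wRv })
      (λ xRy → x , y , (λ u → ⇔.refl) , (λ u → ⇔.refl) , xRy)
      where
        xRy : ∀ {w v} → Cls ℳ w x → Cls ℳ v y → R a w v → R a x y
        xRy {v = v} w~x v~y wRv = from (R-class a∈x xRv y) (v~y a (individually-increasing a∈w wRv))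
          where a∈w = R-dom wRv
                a∈x = Cls-δ w~x a∈w
                xRv = to (R-class a∈w (w~x a a∈w) v) wRv

    private
      module S = SimplicialModel (SC ℳ)
      module Sᵥ = Setoid S.V
    open SetoidMembership S.V using () renaming (_∈_ to _∈ᵥ_)
    open SetoidSubset S.V using () renaming (_⊆_ to _⊆ᵥ_)

    Vertex : Set c
    Vertex = Sᵥ.Carrier

    InFaceOf : World → Vertex → Set (c ⊔ r)
    InFaceOf w x = proj₁ x ∈ₐ δ w × (∀ t → R (proj₁ x) (proj₁ (proj₂ x)) t ⇔ R (proj₁ x) w t)

    verticesAt : World → List Agent → List Vertex
    verticesAt w [] = []
    verticesAt w (a ∷ as) with a ∈? δ w
    ... | yes a∈w = (a , w , a∈w) ∷ verticesAt w as
    ... | no  _   = verticesAt w as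

    Any-verticesAt⁻ : ∀ {q} {Q : Vertex → Set q} w as → Any Q (verticesAt w as) →
                      Σ Agent λ a → Σ (a ∈ₐ δ w) λ a∈w → Q (a , w , a∈w)
    Any-verticesAt⁻ w (a ∷ as) q with a ∈? δ w
    Any-verticesAt⁻ w (a ∷ as) (here qa)  | yes a∈w = a , a∈w , qa
    Any-verticesAt⁻ w (a ∷ as) (there q)  | yes _   = Any-verticesAt⁻ w as q
    Any-verticesAt⁻ w (a ∷ as) q          | no  _   = Any-verticesAt⁻ w as q

    Any-verticesAt⁺ : ∀ {q} {Q : Vertex → Set q} {a} w as → a ∈ₐ δ w → a ∈ₚ as →
                      (∀ a∈w → Q (a , w , a∈w)) → Any Q (verticesAt w as)
    Any-verticesAt⁺ w (b ∷ as) a∈w a∈as qa with b ∈? δ w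
    Any-verticesAt⁺ w (b ∷ as) a∈w (here refl) qa | yes b∈w = here (qa b∈w)
    Any-verticesAt⁺ w (b ∷ as) a∈w (there a∈as) qa | yes _  =
      there (Any-verticesAt⁺ w as a∈w a∈as qa)
    Any-verticesAt⁺ w (b ∷ as) a∈w (here refl) qa | no a∉w  = ⊥-elim (a∉w a∈w)
    Any-verticesAt⁺ w (b ∷ as) a∈w (there a∈as) qa | no _   = Any-verticesAt⁺ w as a∈w a∈as qa

    All-verticesAt : ∀ w as → All (InFaceOf w) (verticesAt w as)
    All-verticesAt w [] = []
    All-verticesAt w (a ∷ as) with a ∈? δ w
    ... | yes a∈w = (a∈w , λ t → ⇔.refl) ∷ All-verticesAt w as
    ... | no  _   = All-verticesAt w as

    faceOf : World → List Vertex
    faceOf w = verticesAt w (allFin (nsuc n))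

    ∈-faceOf⁺ : ∀ {x a w} (a∈w : a ∈ₐ δ w) → x Sᵥ.≈ (a , w , a∈w) → x ∈ᵥ faceOf w
    ∈-faceOf⁺ {a = a} {w} a∈w x≈ = Any-verticesAt⁺ w (allFin (nsuc n)) a∈w (∈-allFin a) (λ _ → x≈)

    ∈-faceOf⁻ : ∀ {x w} → x ∈ᵥ faceOf w → Σ Agent λ a → Σ (a ∈ₐ δ w) λ a∈w → x Sᵥ.≈ (a , w , a∈w)
    ∈-faceOf⁻ {w = w} = Any-verticesAt⁻ w (allFin (nsuc n))

    ∈-faceOf-self : ∀ {a w} (a∈w : a ∈ₐ δ w) → (a , w , a∈w) ∈ᵥ faceOf w
    ∈-faceOf-self {a} {w} a∈w = ∈-faceOf⁺ {x = a , w , a∈w} a∈w (Sᵥ.refl {a , w , a∈w})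

    ∈-faceOf⇒R : ∀ {a u w} {a∈u : a ∈ₐ δ u} → (a , u , a∈u) ∈ᵥ faceOf w → R a u w
    ∈-faceOf⇒R {a} {u} {w} {a∈u} x∈ with ∈-faceOf⁻ {a , u , a∈u} {w} x∈
    ... | _ , a∈w , (refl , same) = from (same w) (S5-refl a∈w)

    faceOf-isFace : ∀ w → S.C (faceOf w)
    faceOf-isFace w =
      Any⇒≢[] (∈-faceOf-self (proj₂ (δ-nonempty w))) , w , All-verticesAt w (allFin (nsuc n))

    InFaceOf⇒∈-faceOf : ∀ {w x} → InFaceOf w x → x ∈ᵥ faceOf w
    InFaceOf⇒∈-faceOf {x = x@(_ , _ , _)} (a∈w , same) = ∈-faceOf⁺ {x = x} a∈w (refl , same)

    face⊆faceOf : ∀ {w X} → All (InFaceOf w) X → X ⊆ᵥ faceOf w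
    face⊆faceOf {w} inX {x} x∈X =
      All.lookupₛ S.V {P = _∈ᵥ faceOf w}
        (λ {y} {z} → SetoidMembershipₚ.∈-resp-≈ S.V {faceOf w} {y} {z})
        (All.map (λ {y} → InFaceOf⇒∈-faceOf {w} {y}) inX) {x} x∈X

    Cls⇒faceOf-⊆ : ∀ {w v} → Cls ℳ w v → faceOf w ⊆ᵥ faceOf v
    Cls⇒faceOf-⊆ {w} {v} w~v {x} x∈ with ∈-faceOf⁻ {x} {w} x∈
    ... | a , a∈w , (refl , same) =
      ∈-faceOf⁺ {x = x} (Cls-δ w~v a∈w)
        (refl , λ t → ⇔.trans (same t) (R-class a∈w (w~v a a∈w) t))

    faceOf-⊆⇒Cls : ∀ {w v} → faceOf w ⊆ᵥ faceOf v → Cls ℳ w v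
    faceOf-⊆⇒Cls {w} {v} w⊆v a a∈w =
      ∈-faceOf⇒R {w = v} {a∈u = a∈w} (w⊆v {a , w , a∈w} (∈-faceOf-self {a} {w} a∈w))

    faceOf-isFacet : ∀ w → IsFacet (SC ℳ) (faceOf w)
    faceOf-isFacet w = faceOf-isFace w , maximal
      where
        maximal : ∀ G → S.C G → faceOf w ⊆ᵥ G → G ⊆ᵥ faceOf w
        maximal G (_ , u , inG) w⊆G {x} x∈G =
          Cls⇒faceOf-⊆ {u} {w} (Cls-sym w~u) {x} (face⊆faceOf {u} {G} inG {x} x∈G)
          where
            w~u : Cls ℳ w u
            w~u = faceOf-⊆⇒Cls {w} {u} (λ {y} y∈ → face⊆faceOf {u} {G} inG {y} (w⊆G {y} y∈))

    facet≈faceOf : (G : Σ (List Vertex) (IsFacet (SC ℳ))) →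
                   ∃ λ u → faceOf u ⊆ᵥ proj₁ G × proj₁ G ⊆ᵥ faceOf u
    facet≈faceOf (G , (_ , u , inG) , maximal) =
      u , (λ {x} → maximal (faceOf u) (faceOf-isFace u) (λ {y} → face⊆faceOf {u} {G} inG {y}) {x}) ,
          (λ {x} → face⊆faceOf {u} {G} inG {x})

    colors-faceOf : ∀ w → colors (SC ℳ) (faceOf w) ≡ δ w
    colors-faceOf w = ⊆-antisym
      (λ a∈ → let _ , a∈w , agent≡ =
                    Any-verticesAt⁻ w (allFin (nsuc n)) (∈-colors⁻ (SC ℳ) (faceOf w) a∈)
              in subst (_∈ₐ δ w) agent≡ a∈w)
      (λ {a} a∈w → ∈-colors⁺ (SC ℳ) (faceOf w)
                     (Any-verticesAt⁺ w (allFin (nsuc n)) a∈w (∈-allFin a) (λ _ → refl)))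

    R⇔sharedVertex : ∀ {a x y} → R a x y ⇔ (∃ λ z → z ∈ᵥ faceOf x × z ∈ᵥ faceOf y × proj₁ z ≡ a)
    R⇔sharedVertex {a} {x} {y} = mk⇔
      (λ xRy → let a∈x = R-dom xRy in
        (a , x , a∈x) , ∈-faceOf-self a∈x ,
        ∈-faceOf⁺ {x = a , x , a∈x} (individually-increasing a∈x xRy) (refl , R-class a∈x xRy) , refl)
      (λ { ((a , u , a∈u) , z∈x , z∈y , refl) →
             to (R-class a∈u (∈-faceOf⇒R {w = x} {a∈u} z∈x) y) (∈-faceOf⇒R {w = y} {a∈u} z∈y) })

    ρ⇔labelledVertex : ∀ {p x a} →
      ρ p x a ⇔ (∃ λ z → z ∈ᵥ faceOf x × S.lab p z × proj₁ z ≡ a)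
    ρ⇔labelledVertex {p} {x} {a} = mk⇔
      (λ pxa → let a∈x = ρ⊆δ pxa in (a , x , a∈x) , ∈-faceOf-self a∈x , lift pxa , refl)
      (λ { ((a , u , a∈u) , z∈x , lift pua , refl) →
             local-predicates pua (∈-faceOf⇒R {w = x} {a∈u} z∈x) })

    properization≅LEM-SC : properization ℳ ≅ᴷ LEM (SC ℳ)
    properization≅LEM-SC = record
      { f      = λ w → faceOf w , faceOf-isFacet w
      ; f-cong = λ {w} {v} w≈v → let w~v = to ≈ᵖʳ⇔Cls w≈v in
                   (λ {x} → Cls⇒faceOf-⊆ {w} {v} w~v {x}) ,
                   (λ {x} → Cls⇒faceOf-⊆ {v} {w} (Cls-sym w~v) {x})
      ; f-inj  = λ {w} {v} (w⊆v , _) → from ≈ᵖʳ⇔Cls (faceOf-⊆⇒Cls {w} {v} (λ {x} → w⊆v {x}))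
      ; f-surj = facet≈faceOf
      ; f-δ    = colors-faceOf
      ; f-R    = λ a w v → ⇔.trans properization-R⇔R
                             (⇔.trans R⇔sharedVertex (mk⇔ lift lower))
      ; f-ρ    = λ p w a → ⇔.trans (mk⇔ lower lift) ρ⇔labelledVertex
      }

  ≅ᴷ-trans : ∀ {c₁ e₁ r₁ c₂ e₂ r₂ c₃ e₃ r₃}
             {ℳ : KripkeModel c₁ e₁ r₁} {𝒩 : KripkeModel c₂ e₂ r₂} {𝒪 : KripkeModel c₃ e₃ r₃} →
             ℳ ≅ᴷ 𝒩 → 𝒩 ≅ᴷ 𝒪 → ℳ ≅ᴷ 𝒪
  ≅ᴷ-trans {𝒪 = 𝒪} i j = record
    { f      = λ w → J.f (I.f w)
    ; f-cong = λ w≈v → J.f-cong (I.f-cong w≈v)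
    ; f-inj  = λ fw≈fv → I.f-inj (J.f-inj fw≈fv)
    ; f-surj = λ y → let x , gx≈y = J.f-surj y ; w , fw≈x = I.f-surj x in
                     w , Setoid.trans (KripkeModel.W 𝒪) (J.f-cong fw≈x) gx≈y
    ; f-δ    = λ w → trans (J.f-δ (I.f w)) (I.f-δ w)
    ; f-R    = λ a w v → ⇔.trans (I.f-R a w v) (J.f-R a (I.f w) (I.f v))
    ; f-ρ    = λ p w a → ⇔.trans (I.f-ρ p w a) (J.f-ρ p (I.f w) a)
    }
    where module I = _≅ᴷ_ i
          module J = _≅ᴷ_ j

  module _ {c e r} {ℳ : KripkeModel c e r} (K : IsKripkeModel ℳ)
           (proper : ∀ w v → Cls ℳ w v ⇔ Setoid._≈_ (KripkeModel.W ℳ) v w) where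
    open KripkeModel ℳ
    open Setoid W using (_≈_) renaming (refl to ≈-refl; sym to ≈-sym; trans to ≈-trans)
    open IsKripkeModel K

    ≈ᵖʳ⇔≈ : ∀ {w v} → (∀ u → Cls ℳ w u ⇔ Cls ℳ v u) ⇔ w ≈ v
    ≈ᵖʳ⇔≈ {w} {v} = mk⇔
      (λ w≈ᵖʳv → ≈-sym (to (proper w v) (from (w≈ᵖʳv v) (from (proper v v) ≈-refl))))
      (λ w≈v u → ⇔.trans (proper w u)
                   (⇔.trans (mk⇔ (λ u≈w → ≈-trans u≈w w≈v) (λ u≈v → ≈-trans u≈v (≈-sym w≈v)))
                            (⇔.sym (proper v u))))

    proper⇒≅properization : ℳ ≅ᴷ properization ℳ
    proper⇒≅properization = record
      { f      = λ w → w
      ; f-cong = from ≈ᵖʳ⇔≈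
      ; f-inj  = to ≈ᵖʳ⇔≈
      ; f-surj = λ w → w , from ≈ᵖʳ⇔≈ ≈-refl
      ; f-δ    = λ w → refl
      ; f-R    = λ a w v → mk⇔
          (λ wRv → w , v , from ≈ᵖʳ⇔≈ ≈-refl , from ≈ᵖʳ⇔≈ ≈-refl , wRv)
          (λ { (w' , v' , w'≈ᵖʳw , v'≈ᵖʳv , w'Rv') →
                 R-resp (to ≈ᵖʳ⇔≈ w'≈ᵖʳw) (to ≈ᵖʳ⇔≈ v'≈ᵖʳv) w'Rv' })
      ; f-ρ    = λ p w a → mk⇔ lift lower
      }

mainTheorem5 : (n : ℕ) (P : Set) → P ↣ ℕ →
    let open Models n P in
    (ExcludedMiddle 0ℓ →
       (𝒞 : SimplicialModel 0ℓ 0ℓ 0ℓ) → IsSimplicialModel 𝒞 → 𝒞 ≅ˢ SC (LEM 𝒞))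
    × ((ℳ : KripkeModel 0ℓ 0ℓ 0ℓ) → IsLocalEpistemicModel ℳ →
         properization ℳ ≅ᴷ LEM (SC ℳ))
    × ((ℳ : KripkeModel 0ℓ 0ℓ 0ℓ) → IsProperLocalEpistemicModel ℳ →
         ℳ ≅ᴷ LEM (SC ℳ))
mainTheorem5 n P _ =
  (λ em 𝒞 isSimplicial → Simplicial.≅SC-LEM isSimplicial em) ,
  (λ ℳ isLEM → LocalEpistemic.properization≅LEM-SC isLEM) ,
  (λ ℳ isProper → let open IsProperLocalEpistemicModel isProper in
     ≅ᴷ-trans (proper⇒≅properization (IsLocalEpistemicModel.isKripke isLocalEpistemic) proper)
              (LocalEpistemic.properization≅LEM-SC isLocalEpistemic))
  where
    open Models n P
    open Duality n P
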